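{- Let $A,B\subseteq\mathbb{Z}$ be finite sets with $|A|\ge 5$ and $|B|\ge 2$. Then $|A\widehat{+}B|=|A|+|B|-3$ if and only if $A=B$ and there exist $\tau,d\in\mathbb{Z}$ with $d\neq 0$ such that $A=\{\tau+id: i=0,1,\dots,|A|-1\}$.
   Context: For finite sets $A,B\subseteq\mathbb{Z}$, the restricted sumset is $A\widehat{+}B=\{a+b: a\in A,\ b\in B,\ a\neq b\}$. A pair with $|A\widehat{+}B|=|A|+|B|-3$ is called a critical pair; a set of the form $\{\tau+id: i=0,\dots,|A|-1\}$ with $d\ne0$ is a standard set, and $(A,B)$ is a standard pair if $A=B$ is a standard set. Throughout the paper all sets considered have at least two elements. -}

module Defs where

open import Data.Nat using (ℕ; _<_)
open import Data.Integer using (ℤ; _+_; _*_; +_)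
import Data.Integer.Properties as ℤP
open import Data.List using (List; length; deduplicate; concatMap; filter)
open import Data.List.Membership.Propositional using (_∈_)
open import Data.List.Relation.Unary.Unique.Propositional using (Unique)
open import Data.Product using (Σ; ∃; _×_; _,_)
open import Relation.Binary.PropositionalEquality using (_≡_; _≢_)
open import Relation.Nullary using (¬_; ¬?)
open import Function.Bundles using (_⇔_)

-- A finite set of integers is represented by a duplicate-free list;
-- its cardinality is the length of the list.
record FinSetℤ : Set where
  constructor finset
  field
    elems  : List ℤ
    unique : Unique elems
open FinSetℤ public

∣_∣ : FinSetℤ → ℕ
∣ A ∣ = length (elems A)

_∈ˢ_ : ℤ → FinSetℤ → Set
x ∈ˢ A = x ∈ elems A

_≐_ : FinSetℤ → FinSetℤ → Set
A ≐ B = ∀ x → (x ∈ˢ A) ⇔ (x ∈ˢ B)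

restrictedSumList : FinSetℤ → FinSetℤ → List ℤ
restrictedSumList A B =
  deduplicate ℤP._≟_
    (concatMap (λ a → Data.List.map (λ b → a + b)
                        (filter (λ b → ¬? (a ℤP.≟ b)) (elems B)))
               (elems A))

restrictedSumCard : FinSetℤ → FinSetℤ → ℕ
restrictedSumCard A B = length (restrictedSumList A B)

IsStandard : FinSetℤ → Set
IsStandard A = Σ ℤ λ τ → Σ ℤ λ d → (d ≢ + 0) ×
  (∀ x → (x ∈ˢ A) ⇔ (Σ ℕ λ i → (i < ∣ A ∣) × (x ≡ τ + (+ i) * d)))

-- For nonempty X, Y with y₀ = min Y and x₁ = max X, the sums (X ∖ y₀) + y₀ followed by
-- x₁ + (Y ∖ {y₀, x₁}) form an increasing chain inside X +̂ Y, so |X +̂ Y| ≥ |X| + |Y| − 3;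
-- equality forces y₀ ∈ X, x₁ ∈ Y and X +̂ Y to be exactly this chain, and comparing the
-- chains of (A, B) and (B, A) gives A = B. If A +̂ A is critical, a chain of four blocks shows
-- that any two successive pairs u ⋖ w < v ⋖ v' of A satisfy u + v' = w + v, i.e. have equal
-- gaps; with |A| ≥ 5 every gap can be compared with the first, so A is an arithmetic
-- progression. Conversely the restricted sums of {τ + i d : i < n} lie among the 2n − 3
-- values 2τ + s d with 1 ≤ s ≤ 2n − 3.

module Submission where

open import Defs
open import Data.Nat using (ℕ; _+_; _≤_)
open import Data.Product using (_×_)
open import Relation.Binary.PropositionalEquality using (_≡_)
open import Function.Bundles using (_⇔_)

open import Data.Nat using (zero; suc; _<_; _∸_; z≤n; s≤s)
import Data.Nat.Properties as ℕₚ
open import Data.Nat.Tactic.RingSolver using (solve-∀)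
open import Data.Integer as ℤ using (ℤ; _-_)
import Data.Integer.Properties as ℤₚ
import Data.Integer.Tactic.RingSolver as ℤ-Ring
open import Algebra.Properties.AbelianGroup ℤₚ.+-0-abelianGroup using (∙-cancelˡ; ∙-cancelʳ)
open import Data.List using (List; []; _∷_; length; filter; map; _++_; applyUpTo)
open import Data.List.Properties using (length-++; length-map; length-applyUpTo; filter-notAll; filter-some)
open import Data.List.Membership.Propositional using (_∈_; _∉_; find)
open import Data.List.Membership.Propositional.Properties
  using ( ∈-filter⁺; ∈-filter⁻; ∈-map⁻; ∈-map⁺; ∈-++⁻; ∈-applyUpTo⁺; ∈-applyUpTo⁻
        ; ∈-deduplicate⁺; ∈-deduplicate⁻; ∈-concatMap⁺; ∈-concatMap⁻)
open import Data.List.Relation.Binary.Subset.Propositional using (_⊆_)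
open import Data.List.Relation.Unary.All as All using (All; []; _∷_)
import Data.List.Relation.Unary.All.Properties as Allₚ
open import Data.List.Relation.Unary.Any as Any using (here; there)
open import Data.List.Relation.Unary.Unique.Propositional using (Unique)
import Data.List.Relation.Unary.Unique.Propositional.Properties as Unique
open import Data.List.Relation.Unary.AllPairs using (_∷_)
open import Data.List.Extrema ℤₚ.≤-totalOrder
  using (min; max; argmin-sel; argmax-sel; min≤⊤; min≤xs; ⊥≤max; xs≤max)
open import Data.Product using (∃; ∃-syntax; _,_; proj₁; proj₂)
open import Data.Sum using (_⊎_; inj₁; inj₂; [_,_]′)
open import Data.Empty using (⊥-elim)
open import Relation.Nullary using (¬_; yes; no; ¬?; contradiction)
open import Relation.Unary using (Pred; Decidable)
open import Relation.Binary.Definitions using (DecidableEquality; tri<; tri≈; tri>)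
open import Relation.Binary.PropositionalEquality
  using (_≢_; refl; sym; trans; cong; cong₂; subst; module ≡-Reasoning)
open import Function.Bundles using (mk⇔; Equivalence)
open import Function using (id)
open import Data.List.Membership.DecPropositional ℤₚ._≟_ using (_∈?_)
open import Data.List.Relation.Unary.Unique.DecPropositional.Properties ℤₚ._≟_ using (deduplicate-!)

module DuplicateFree {a} {A : Set a} (_≟_ : DecidableEquality A) where

  open ℕₚ.≤-Reasoning

  infixl 6 _∖_
  _∖_ : List A → A → List A
  xs ∖ x = filter (λ y → ¬? (y ≟ x)) xs

  ∈-∖⁺ : ∀ {x y xs} → y ∈ xs → y ≢ x → y ∈ xs ∖ x
  ∈-∖⁺ {x} = ∈-filter⁺ (λ y → ¬? (y ≟ x))

  ∈-∖⁻ : ∀ {x y} xs → y ∈ xs ∖ x → y ∈ xs × y ≢ x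
  ∈-∖⁻ {x} xs = ∈-filter⁻ (λ y → ¬? (y ≟ x)) {xs = xs}

  ∖-unique : ∀ {x xs} → Unique xs → Unique (xs ∖ x)
  ∖-unique {x} = Unique.filter⁺ (λ y → ¬? (y ≟ x))

  length-∖-< : ∀ {x xs} → x ∈ xs → length (xs ∖ x) < length xs
  length-∖-< {x} {xs} x∈xs =
    filter-notAll (λ y → ¬? (y ≟ x)) xs (Any.map (λ { refl x≢x → x≢x refl }) x∈xs)

  Unique-⊆⇒length≤ : ∀ {xs ys} → Unique xs → xs ⊆ ys → length xs ≤ length ys
  Unique-⊆⇒length≤ {[]}     _             _     = z≤n
  Unique-⊆⇒length≤ {x ∷ xs} {ys} (x∉xs ∷ xs!) x∷xs⊆ys = begin-strict
    length xs        ≤⟨ Unique-⊆⇒length≤ xs! xs⊆ys∖x ⟩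
    length (ys ∖ x)  <⟨ length-∖-< (x∷xs⊆ys (here refl)) ⟩
    length ys        ∎
    where
    xs⊆ys∖x : xs ⊆ ys ∖ x
    xs⊆ys∖x y∈xs = ∈-∖⁺ (x∷xs⊆ys (there y∈xs)) (λ y≡x → All.lookup x∉xs y∈xs (sym y≡x))

  Unique-⊆-length≤⇒⊇ : ∀ {xs ys} → Unique xs → xs ⊆ ys → length ys ≤ length xs → ys ⊆ xs
  Unique-⊆-length≤⇒⊇ {xs} {ys} xs! xs⊆ys |ys|≤|xs| {z} z∈ys with Any.any? (z ≟_) xs
  ... | yes z∈xs = z∈xs
  ... | no  z∉xs = contradiction (Unique-⊆⇒length≤ (z≢xs ∷ xs!) z∷xs⊆ys) (ℕₚ.≤⇒≯ |ys|≤|xs|)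
    where
    z≢xs : All (z ≢_) xs
    z≢xs = All.tabulate (λ w∈xs z≡w → z∉xs (subst (_∈ xs) (sym z≡w) w∈xs))
    z∷xs⊆ys : (z ∷ xs) ⊆ ys
    z∷xs⊆ys (here refl) = z∈ys
    z∷xs⊆ys (there w∈xs) = xs⊆ys w∈xs

  length≤1+length-∖ : ∀ x {xs} → Unique xs → length xs ≤ suc (length (xs ∖ x))
  length≤1+length-∖ x {xs} xs! = Unique-⊆⇒length≤ xs! xs⊆x∷xs∖x
    where
    xs⊆x∷xs∖x : xs ⊆ x ∷ xs ∖ x
    xs⊆x∷xs∖x {y} y∈xs with y ≟ x
    ... | yes y≡x = here y≡x
    ... | no  y≢x = there (∈-∖⁺ y∈xs y≢x)

  ∉⇒length≤length-∖ : ∀ {x xs} → Unique xs → x ∉ xs → length xs ≤ length (xs ∖ x)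
  ∉⇒length≤length-∖ xs! x∉xs =
    Unique-⊆⇒length≤ xs! (λ y∈xs → ∈-∖⁺ y∈xs (λ { refl → x∉xs y∈xs }))

open DuplicateFree ℤₚ._≟_

length≤length-filter+length-filter :
  ∀ {a p q} {A : Set a} {P : Pred A p} {Q : Pred A q} (P? : Decidable P) (Q? : Decidable Q) xs →
  (∀ {x} → x ∈ xs → P x ⊎ Q x) → length xs ≤ length (filter P? xs) + length (filter Q? xs)
length≤length-filter+length-filter P? Q? [] _ = z≤n
length≤length-filter+length-filter P? Q? (x ∷ xs) P⊎Q
  with P? x | Q? x | length≤length-filter+length-filter P? Q? xs (λ x∈xs → P⊎Q (there x∈xs))
... | yes _ | yes _ | ih = s≤s (ℕₚ.≤-trans ih (ℕₚ.+-monoʳ-≤ (length (filter P? xs)) (ℕₚ.n≤1+n _)))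
... | yes _ | no  _ | ih = s≤s ih
... | no  _ | yes _ | ih = ℕₚ.≤-trans (s≤s ih) (ℕₚ.≤-reflexive (sym (ℕₚ.+-suc _ _)))
... | no ¬p | no ¬q | _  = ⊥-elim ([ ¬p , ¬q ]′ (P⊎Q (here refl)))

+-mono-≤-regroup : ∀ i j {m n a b} → m ≤ i + a → n ≤ j + b → m + n ≤ (i + j) + (a + b)
+-mono-≤-regroup i j {a = a} {b} m≤ n≤ =
  ℕₚ.≤-trans (ℕₚ.+-mono-≤ m≤ n≤) (ℕₚ.≤-reflexive (regroup i a j b))
  where
  regroup : ∀ i a j b → (i + a) + (j + b) ≡ (i + j) + (a + b)
  regroup = solve-∀

length-map-++ : ∀ {a} {A B : Set a} (f : A → B) xs ys → length (map f xs ++ ys) ≡ length xs + length ys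
length-map-++ f xs ys = trans (length-++ (map f xs)) (cong (_+ length ys) (length-map f xs))

applyUpTo-⊆-suc : ∀ {a} {A : Set a} (f : ℕ → A) n → applyUpTo f n ⊆ applyUpTo f (suc n)
applyUpTo-⊆-suc f n z∈ with ∈-applyUpTo⁻ f z∈
... | i , i<n , refl = ∈-applyUpTo⁺ f (ℕₚ.m≤n⇒m≤1+n i<n)

m+[n-m]≡n : ∀ m n → m ℤ.+ (n - m) ≡ n
m+[n-m]≡n = ℤ-Ring.solve-∀

IsLeast : List ℤ → ℤ → Set
IsLeast xs μ = μ ∈ xs × (∀ {z} → z ∈ xs → μ ℤ.≤ z)

IsGreatest : List ℤ → ℤ → Set
IsGreatest xs μ = μ ∈ xs × (∀ {z} → z ∈ xs → z ℤ.≤ μ)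

least : ∀ xs → 1 ≤ length xs → ∃ (IsLeast xs)
least (x ∷ xs) _ = min x xs , [ here , there ]′ (argmin-sel id x xs) , λ
  { (here refl) → min≤⊤ x xs
  ; (there z∈xs) → All.lookup (min≤xs x xs) z∈xs
  }

greatest : ∀ xs → 1 ≤ length xs → ∃ (IsGreatest xs)
greatest (x ∷ xs) _ = max x xs , [ here , there ]′ (argmax-sel id x xs) , λ
  { (here refl) → ⊥≤max x xs
  ; (there z∈xs) → All.lookup (xs≤max x xs) z∈xs
  }

≤⊎> : ∀ x c → x ℤ.≤ c ⊎ c ℤ.< x
≤⊎> x c with x ℤₚ.≤? c
... | yes x≤c = inj₁ x≤c
... | no  x≰c = inj₂ (ℤₚ.≰⇒> x≰c)

∈-map-filter⁻ : ∀ {p} {P : Pred ℤ p} (P? : Decidable P) (f : ℤ → ℤ) xs {z} →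
  z ∈ map f (filter P? xs) → ∃[ x ] x ∈ xs × P x × z ≡ f x
∈-map-filter⁻ P? f xs z∈ with ∈-map⁻ f z∈
... | x , x∈ , z≡fx with ∈-filter⁻ P? {xs = xs} x∈
... | x∈xs , Px = x , x∈xs , Px , z≡fx

++-unique-separated : ∀ {m xs ys} → Unique xs → Unique ys →
  All (ℤ._≤ m) xs → All (m ℤ.<_) ys → Unique (xs ++ ys)
++-unique-separated xs! ys! xs≤m m<ys = Unique.++⁺ xs! ys! λ (z∈xs , z∈ys) →
  ℤₚ.<-irrefl refl (ℤₚ.≤-<-trans (All.lookup xs≤m z∈xs) (All.lookup m<ys z∈ys))

+-translateˡ-unique : ∀ c {xs} → Unique xs → Unique (map (λ x → c ℤ.+ x) xs)
+-translateˡ-unique c = Unique.map⁺ (∙-cancelˡ c _ _)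

+-translateʳ-unique : ∀ c {xs} → Unique xs → Unique (map (ℤ._+ c) xs)
+-translateʳ-unique c = Unique.map⁺ (∙-cancelʳ c _ _)

infix 4 _+̂_⊆_
_+̂_⊆_ : List ℤ → List ℤ → List ℤ → Set
X +̂ Y ⊆ T = ∀ {x y} → x ∈ X → y ∈ Y → x ≢ y → x ℤ.+ y ∈ T

+̂-⊆-comm : ∀ {X Y T} → X +̂ Y ⊆ T → Y +̂ X ⊆ T
+̂-⊆-comm {T = T} sums {y} {x} y∈Y x∈X y≢x =
  subst (_∈ T) (ℤₚ.+-comm x y) (sums x∈X y∈Y (λ x≡y → y≢x (sym x≡y)))

restrictedSumList-unique : ∀ A B → Unique (restrictedSumList A B)
restrictedSumList-unique A B = deduplicate-! _

sumsFrom : FinSetℤ → ℤ → List ℤ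
sumsFrom B a = map (λ b → a ℤ.+ b) (filter (λ b → ¬? (a ℤₚ.≟ b)) (elems B))

restrictedSumList-⊇ : ∀ A B → elems A +̂ elems B ⊆ restrictedSumList A B
restrictedSumList-⊇ A B {a} a∈A b∈B a≢b =
  ∈-deduplicate⁺ ℤₚ._≟_ (∈-concatMap⁺ (sumsFrom B) (Any.map (λ { refl → a+b∈ }) a∈A))
  where
  a+b∈ : a ℤ.+ _ ∈ sumsFrom B a
  a+b∈ = ∈-map⁺ (λ b → a ℤ.+ b) (∈-filter⁺ (λ b → ¬? (a ℤₚ.≟ b)) b∈B a≢b)

∈-restrictedSumList⁻ : ∀ A B {z} → z ∈ restrictedSumList A B →
  ∃[ a ] ∃[ b ] a ∈ elems A × b ∈ elems B × a ≢ b × z ≡ a ℤ.+ b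
∈-restrictedSumList⁻ A B z∈
  with find (∈-concatMap⁻ (sumsFrom B) {xs = elems A} (∈-deduplicate⁻ ℤₚ._≟_ _ z∈))
... | a , a∈A , z∈a+B with ∈-map⁻ (λ b → a ℤ.+ b) z∈a+B
... | b , b∈B' , z≡a+b with ∈-filter⁻ (λ b → ¬? (a ℤₚ.≟ b)) {xs = elems B} b∈B'
... | b∈B , a≢b = a , b , a∈A , b∈B , a≢b , z≡a+b

≐⇒∣∣≡ : ∀ A B → A ≐ B → ∣ A ∣ ≡ ∣ B ∣
≐⇒∣∣≡ A B A≐B = ℕₚ.≤-antisym
  (Unique-⊆⇒length≤ (unique A) (λ {x} → Equivalence.to (A≐B x)))
  (Unique-⊆⇒length≤ (unique B) (λ {x} → Equivalence.from (A≐B x)))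

module _ {D T : List ℤ} (D! : Unique D) (D⊆T : D ⊆ T) {n} (critical : length T + 3 ≡ n) where

  open ℕₚ.≤-Reasoning

  critical⇒⊇ : n ≤ 3 + length D → T ⊆ D
  critical⇒⊇ n≤3+|D| = Unique-⊆-length≤⇒⊇ D! D⊆T (ℕₚ.+-cancelˡ-≤ 3 _ _ (begin
    3 + length T  ≡⟨ ℕₚ.+-comm 3 (length T) ⟩
    length T + 3  ≡⟨ critical ⟩
    n             ≤⟨ n≤3+|D| ⟩
    3 + length D  ∎))

  critical⇒≰2+length : ¬ (n ≤ 2 + length D)
  critical⇒≰2+length n≤2+|D| = ℕₚ.<-irrefl refl (begin-strict
    3 + length T  ≡⟨ ℕₚ.+-comm 3 (length T) ⟩
    length T + 3  ≡⟨ critical ⟩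
    n             ≤⟨ n≤2+|D| ⟩
    2 + length D  <⟨ s≤s (ℕₚ.+-monoʳ-≤ 2 (Unique-⊆⇒length≤ D! D⊆T)) ⟩
    3 + length T  ∎)

-- The chain X + y₀ < x₁ + Y

module Chain {X Y : List ℤ} (X! : Unique X) (Y! : Unique Y) {y₀ x₁ : ℤ}
  (y₀-least : IsLeast Y y₀) (x₁-greatest : IsGreatest X x₁) where

  open ℕₚ.≤-Reasoning

  lower upper chain : List ℤ
  lower = map (ℤ._+ y₀) (X ∖ y₀)
  upper = map (λ y → x₁ ℤ.+ y) (Y ∖ y₀ ∖ x₁)
  chain = lower ++ upper

  ∈-lower⁻ : ∀ {z} → z ∈ lower → ∃[ x ] x ∈ X × x ≢ y₀ × z ≡ x ℤ.+ y₀
  ∈-lower⁻ z∈ with ∈-map⁻ (ℤ._+ y₀) z∈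
  ... | x , x∈ , z≡ with ∈-∖⁻ X x∈
  ... | x∈X , x≢y₀ = x , x∈X , x≢y₀ , z≡

  ∈-upper⁻ : ∀ {z} → z ∈ upper → ∃[ y ] y ∈ Y × y₀ ℤ.< y × y ≢ x₁ × z ≡ x₁ ℤ.+ y
  ∈-upper⁻ z∈ with ∈-map⁻ (λ y → x₁ ℤ.+ y) z∈
  ... | y , y∈ , z≡ with ∈-∖⁻ (Y ∖ y₀) y∈
  ... | y∈' , y≢x₁ with ∈-∖⁻ Y y∈'
  ... | y∈Y , y≢y₀ =
    y , y∈Y , ℤₚ.≤∧≢⇒< (proj₂ y₀-least y∈Y) (λ y₀≡y → y≢y₀ (sym y₀≡y)) , y≢x₁ , z≡

  chain-unique : Unique chain
  chain-unique = ++-unique-separated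
    (+-translateʳ-unique y₀ (∖-unique X!))
    (+-translateˡ-unique x₁ (∖-unique (∖-unique Y!)))
    (All.tabulate λ z∈ → case-lower (∈-lower⁻ z∈))
    (All.tabulate λ z∈ → case-upper (∈-upper⁻ z∈))
    where
    case-lower : ∀ {z} → ∃[ x ] x ∈ X × x ≢ y₀ × z ≡ x ℤ.+ y₀ → z ℤ.≤ x₁ ℤ.+ y₀
    case-lower (x , x∈X , _ , refl) = ℤₚ.+-monoˡ-≤ y₀ (proj₂ x₁-greatest x∈X)
    case-upper : ∀ {z} → ∃[ y ] y ∈ Y × y₀ ℤ.< y × y ≢ x₁ × z ≡ x₁ ℤ.+ y → x₁ ℤ.+ y₀ ℤ.< z
    case-upper (y , _ , y₀<y , _ , refl) = ℤₚ.+-monoʳ-< x₁ y₀<y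

  chain-⊆ : ∀ {T} → X +̂ Y ⊆ T → chain ⊆ T
  chain-⊆ sums z∈ with ∈-++⁻ lower z∈
  ... | inj₁ z∈lower with ∈-lower⁻ z∈lower
  ...   | x , x∈X , x≢y₀ , refl = sums x∈X (proj₁ y₀-least) x≢y₀
  chain-⊆ sums z∈ | inj₂ z∈upper with ∈-upper⁻ z∈upper
  ...   | y , y∈Y , _ , y≢x₁ , refl = sums (proj₁ x₁-greatest) y∈Y (λ x₁≡y → y≢x₁ (sym x₁≡y))

  length-chain : length chain ≡ length (X ∖ y₀) + length (Y ∖ y₀ ∖ x₁)
  length-chain = trans (length-map-++ _ (X ∖ y₀) upper)
                       (cong (length (X ∖ y₀) +_) (length-map _ (Y ∖ y₀ ∖ x₁)))

  length-Y : length Y ≤ 2 + length (Y ∖ y₀ ∖ x₁)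
  length-Y = ℕₚ.≤-trans (length≤1+length-∖ y₀ Y!) (s≤s (length≤1+length-∖ x₁ (∖-unique Y!)))

  length≤3+length-chain : length X + length Y ≤ 3 + length chain
  length≤3+length-chain = begin
    length X + length Y
      ≤⟨ +-mono-≤-regroup 1 2 (length≤1+length-∖ y₀ X!) length-Y ⟩
    3 + (length (X ∖ y₀) + length (Y ∖ y₀ ∖ x₁))
      ≡⟨ cong (3 +_) length-chain ⟨
    3 + length chain ∎

  y₀∉X⇒length≤2+length-chain : y₀ ∉ X → length X + length Y ≤ 2 + length chain
  y₀∉X⇒length≤2+length-chain y₀∉X = begin
    length X + length Y
      ≤⟨ +-mono-≤-regroup 0 2 (∉⇒length≤length-∖ X! y₀∉X) length-Y ⟩
    2 + (length (X ∖ y₀) + length (Y ∖ y₀ ∖ x₁))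
      ≡⟨ cong (2 +_) length-chain ⟨
    2 + length chain ∎

  x₁∉Y⇒length≤2+length-chain : x₁ ∉ Y → length X + length Y ≤ 2 + length chain
  x₁∉Y⇒length≤2+length-chain x₁∉Y = begin
    length X + length Y
      ≤⟨ +-mono-≤-regroup 1 1 (length≤1+length-∖ y₀ X!) length-Y' ⟩
    2 + (length (X ∖ y₀) + length (Y ∖ y₀ ∖ x₁))
      ≡⟨ cong (2 +_) length-chain ⟨
    2 + length chain ∎
    where
    length-Y' : length Y ≤ 1 + length (Y ∖ y₀ ∖ x₁)
    length-Y' = ℕₚ.≤-trans (length≤1+length-∖ y₀ Y!)
      (s≤s (∉⇒length≤length-∖ (∖-unique Y!) (λ x₁∈ → x₁∉Y (proj₁ (∈-∖⁻ Y x₁∈)))))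

  module Critical {T} (sums : X +̂ Y ⊆ T) (critical : length T + 3 ≡ length X + length Y) where

    y₀∈X : y₀ ∈ X
    y₀∈X with y₀ ∈? X
    ... | yes y₀∈X = y₀∈X
    ... | no  y₀∉X = contradiction (y₀∉X⇒length≤2+length-chain y₀∉X)
                       (critical⇒≰2+length chain-unique (chain-⊆ sums) critical)

    x₁∈Y : x₁ ∈ Y
    x₁∈Y with x₁ ∈? Y
    ... | yes x₁∈Y = x₁∈Y
    ... | no  x₁∉Y = contradiction (x₁∉Y⇒length≤2+length-chain x₁∉Y)
                       (critical⇒≰2+length chain-unique (chain-⊆ sums) critical)

    T⊆chain : T ⊆ chain
    T⊆chain = critical⇒⊇ chain-unique (chain-⊆ sums) critical length≤3+length-chain

    -- y₀ + y lies in the chain; below x₁ it cannot lie in the upper part.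
    ⊆-if-below : (∀ {y} → y ∈ Y → y ℤ.≤ x₁) → Y ⊆ X
    ⊆-if-below Y≤x₁ {y} y∈Y with y ℤₚ.≟ y₀
    ... | yes refl = y₀∈X
    ... | no y≢y₀ with ∈-++⁻ lower (T⊆chain (sums y₀∈X y∈Y (λ y₀≡y → y≢y₀ (sym y₀≡y))))
    ...   | inj₁ ∈lower with ∈-lower⁻ ∈lower
    ...     | x , x∈X , _ , y₀+y≡x+y₀ =
      subst (_∈ X) (∙-cancelʳ y₀ x y (trans (sym y₀+y≡x+y₀) (ℤₚ.+-comm y₀ y))) x∈X
    ⊆-if-below Y≤x₁ {y} y∈Y | no _ | inj₂ ∈upper with ∈-upper⁻ ∈upper
    ...     | y' , _ , y₀<y' , _ , y₀+y≡x₁+y' = contradiction y₀+y≡x₁+y' (ℤₚ.<⇒≢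
      (subst (ℤ._< x₁ ℤ.+ y') (ℤₚ.+-comm y y₀) (ℤₚ.+-mono-≤-< (Y≤x₁ y∈Y) y₀<y')))

restrictedSum-lower-bound : ∀ {X Y T} → Unique X → Unique Y → 1 ≤ length X → 1 ≤ length Y →
  X +̂ Y ⊆ T → length X + length Y ≤ 3 + length T
restrictedSum-lower-bound {X} {Y} X! Y! X≢[] Y≢[] sums =
  ℕₚ.≤-trans length≤3+length-chain (ℕₚ.+-monoʳ-≤ 3 (Unique-⊆⇒length≤ chain-unique (chain-⊆ sums)))
  where open Chain X! Y! (proj₂ (least Y Y≢[])) (proj₂ (greatest X X≢[]))

critical⇒≐ : ∀ A B → 1 ≤ ∣ A ∣ → 1 ≤ ∣ B ∣ →
  restrictedSumCard A B + 3 ≡ ∣ A ∣ + ∣ B ∣ → A ≐ B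
critical⇒≐ A B A≢[] B≢[] critical x = mk⇔ A⊆B B⊆A
  where
  maxA : ∃ (IsGreatest (elems A))
  maxA = greatest (elems A) A≢[]
  maxB : ∃ (IsGreatest (elems B))
  maxB = greatest (elems B) B≢[]
  open Chain
  module AB = Critical (unique A) (unique B) (proj₂ (least (elems B) B≢[])) (proj₂ maxA)
    (restrictedSumList-⊇ A B) critical
  module BA = Critical (unique B) (unique A) (proj₂ (least (elems A) A≢[])) (proj₂ maxB)
    (+̂-⊆-comm (restrictedSumList-⊇ A B)) (trans critical (ℕₚ.+-comm ∣ A ∣ ∣ B ∣))
  maxA≡maxB : proj₁ maxA ≡ proj₁ maxB
  maxA≡maxB = ℤₚ.≤-antisym (proj₂ (proj₂ maxB) AB.x₁∈Y) (proj₂ (proj₂ maxA) BA.x₁∈Y)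
  B⊆A : x ∈ elems B → x ∈ elems A
  B⊆A = AB.⊆-if-below (λ y∈B → subst (_ ℤ.≤_) (sym maxA≡maxB) (proj₂ (proj₂ maxB) y∈B))
  A⊆B : x ∈ elems A → x ∈ elems B
  A⊆B = BA.⊆-if-below (λ y∈A → subst (_ ℤ.≤_) maxA≡maxB (proj₂ (proj₂ maxA) y∈A))

-- Critical restricted squares

module CriticalSquare {X T : List ℤ} (X! : Unique X) (sums : X +̂ X ⊆ T)
  (critical : length T + 3 ≡ length X + length X)
  {lo hi : ℤ} (lo-least : IsLeast X lo) (hi-greatest : IsGreatest X hi) where

  infix 4 _⋖_
  _⋖_ : ℤ → ℤ → Set
  x ⋖ y = y ∈ X × x ℤ.< y × (∀ {z} → z ∈ X → x ℤ.< z → y ℤ.≤ z)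

  ⋖-unique : ∀ {x y y'} → x ⋖ y → x ⋖ y' → y ≡ y'
  ⋖-unique (y∈X , x<y , y-least) (y'∈X , x<y' , y'-least) =
    ℤₚ.≤-antisym (y-least y'∈X x<y') (y'-least y∈X x<y)

  X⁺ : List ℤ
  X⁺ = X ∖ lo

  ∈-X⁺⁻ : ∀ {a} → a ∈ X⁺ → a ∈ X × lo ℤ.< a
  ∈-X⁺⁻ a∈ with ∈-∖⁻ X a∈
  ... | a∈X , a≢lo = a∈X , ℤₚ.≤∧≢⇒< (proj₂ lo-least a∈X) (λ lo≡a → a≢lo (sym lo≡a))

  module _ {p} {P : Pred ℤ p} (P? : Decidable P) (f : ℤ → ℤ) where

    ∈-block⁻ : ∀ {z} → z ∈ map f (filter P? X⁺) → ∃[ a ] a ∈ X × lo ℤ.< a × P a × z ≡ f a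
    ∈-block⁻ z∈ with ∈-map-filter⁻ P? f X⁺ z∈
    ... | a , a∈X⁺ , Pa , z≡fa with ∈-X⁺⁻ a∈X⁺
    ... | a∈X , lo<a = a , a∈X , lo<a , Pa , z≡fa

    block-unique : (∀ {a b} → f a ≡ f b → a ≡ b) → Unique (map f (filter P? X⁺))
    block-unique f-injective = Unique.map⁺ f-injective (Unique.filter⁺ P? (∖-unique X!))

    block-bound : ∀ {q} {R : Pred ℤ q} → (∀ {a} → a ∈ X → lo ℤ.< a → P a → R (f a)) →
                  All R (map f (filter P? X⁺))
    block-bound R-f = Allₚ.map⁺ (All.tabulate λ a∈ →
      let (a∈X⁺ , Pa) = ∈-filter⁻ P? {xs = X⁺} a∈ ; (a∈X , lo<a) = ∈-X⁺⁻ a∈X⁺ in R-f a∈X lo<a Pa)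

  -- For successive pairs u ⋖ w < v ⋖ v' the critical bound forces T to be the union of
  -- four translates of parts of X, and u + v' can only lie in the second one, as w + v.
  module Exchange {u w v v'} (u∈X : u ∈ X) (u⋖w : u ⋖ w) (v∈X : v ∈ X) (v⋖v' : v ⋖ v')
                  (w<v : w ℤ.< v) where

    open ℕₚ.≤-Reasoning

    w∈X : w ∈ X
    w∈X = proj₁ u⋖w
    u<w : u ℤ.< w
    u<w = proj₁ (proj₂ u⋖w)
    v'∈X : v' ∈ X
    v'∈X = proj₁ v⋖v'
    v<v' : v ℤ.< v'
    v<v' = proj₁ (proj₂ v⋖v')
    lo<w : lo ℤ.< w
    lo<w = ℤₚ.≤-<-trans (proj₂ lo-least u∈X) u<w
    v<hi : v ℤ.< hi
    v<hi = ℤₚ.<-≤-trans v<v' (proj₂ hi-greatest v'∈X)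

    X⁺>w : List ℤ
    X⁺>w = filter (w ℤₚ.<?_) X⁺

    block₁ block₂ block₃ block₄ blocks : List ℤ
    block₁ = map (λ a → lo ℤ.+ a) (filter (ℤₚ._≤? v) X⁺)
    block₂ = map (ℤ._+ v) (filter (ℤₚ._≤? w) X⁺)
    block₃ = map (λ a → w ℤ.+ a) (filter (v ℤₚ.<?_) X⁺)
    block₄ = map (ℤ._+ hi) (X⁺>w ∖ hi)
    blocks = block₁ ++ block₂ ++ block₃ ++ block₄

    ∈-block₄⁻ : ∀ {z} → z ∈ block₄ → ∃[ a ] a ∈ X × w ℤ.< a × a ≢ hi × z ≡ a ℤ.+ hi
    ∈-block₄⁻ z∈ with ∈-map⁻ (ℤ._+ hi) z∈
    ... | a , a∈ , z≡ with ∈-∖⁻ X⁺>w a∈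
    ... | a∈X⁺>w , a≢hi with ∈-filter⁻ (w ℤₚ.<?_) {xs = X⁺} a∈X⁺>w
    ... | a∈X⁺ , w<a = a , proj₁ (∈-X⁺⁻ a∈X⁺) , w<a , a≢hi , z≡

    block₄-unique : Unique block₄
    block₄-unique = +-translateʳ-unique hi (∖-unique (Unique.filter⁺ (w ℤₚ.<?_) (∖-unique X!)))

    block₄-bound : All (λ z → w ℤ.+ hi ℤ.< z) block₄
    block₄-bound = All.tabulate λ z∈ → case (∈-block₄⁻ z∈)
      where
      case : ∀ {z} → ∃[ a ] a ∈ X × w ℤ.< a × a ≢ hi × z ≡ a ℤ.+ hi → w ℤ.+ hi ℤ.< z
      case (_ , _ , w<a , _ , refl) = ℤₚ.+-monoˡ-< hi w<a

    blocks-unique : Unique blocks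
    blocks-unique =
      ++-unique-separated (block-unique _ _ (∙-cancelˡ lo _ _))
        (++-unique-separated (block-unique _ _ (∙-cancelʳ v _ _))
          (++-unique-separated (block-unique _ _ (∙-cancelˡ w _ _)) block₄-unique
            (block-bound _ _ (λ a∈X _ _ → ℤₚ.+-monoʳ-≤ w (proj₂ hi-greatest a∈X)))
            block₄-bound)
          (block-bound _ _ (λ _ _ a≤w → ℤₚ.+-monoˡ-≤ v a≤w))
          above-w+v)
        (block-bound _ _ (λ _ _ a≤v → ℤₚ.+-monoʳ-≤ lo a≤v))
        (Allₚ.++⁺ (block-bound _ _ (λ _ lo<a _ → ℤₚ.+-monoˡ-< v lo<a))
                  (All.map (ℤₚ.<-trans (ℤₚ.+-monoˡ-< v lo<w)) above-w+v))
      where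
      above-w+v : All (λ z → w ℤ.+ v ℤ.< z) (block₃ ++ block₄)
      above-w+v = Allₚ.++⁺ (block-bound _ _ (λ _ _ v<a → ℤₚ.+-monoʳ-< w v<a))
                           (All.map (ℤₚ.<-trans (ℤₚ.+-monoʳ-< w v<hi)) block₄-bound)

    blocks-⊆ : blocks ⊆ T
    blocks-⊆ z∈ with ∈-++⁻ block₁ z∈
    ... | inj₁ z∈₁ with ∈-block⁻ (ℤₚ._≤? v) _ z∈₁
    ...   | a , a∈X , lo<a , _ , refl = sums (proj₁ lo-least) a∈X (ℤₚ.<⇒≢ lo<a)
    blocks-⊆ z∈ | inj₂ z∈' with ∈-++⁻ block₂ z∈'
    ... | inj₁ z∈₂ with ∈-block⁻ (ℤₚ._≤? w) _ z∈₂
    ...   | a , a∈X , _ , a≤w , refl = sums a∈X v∈X (ℤₚ.<⇒≢ (ℤₚ.≤-<-trans a≤w w<v))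
    blocks-⊆ z∈ | inj₂ _ | inj₂ z∈'' with ∈-++⁻ block₃ z∈''
    ... | inj₁ z∈₃ with ∈-block⁻ (v ℤₚ.<?_) _ z∈₃
    ...   | a , a∈X , _ , v<a , refl = sums w∈X a∈X (ℤₚ.<⇒≢ (ℤₚ.<-trans w<v v<a))
    blocks-⊆ z∈ | inj₂ _ | inj₂ _ | inj₂ z∈₄ with ∈-block₄⁻ z∈₄
    ...   | a , a∈X , _ , a≢hi , refl = sums a∈X (proj₁ hi-greatest) a≢hi

    length≤3+length-blocks : length X + length X ≤ 3 + length blocks
    length≤3+length-blocks = begin
      length X + length X                ≤⟨ ℕₚ.+-mono-≤ X≤1+X⁺ X≤1+X⁺ ⟩
      suc (length X⁺) + suc (length X⁺)  ≤⟨ ℕₚ.+-mono-≤ (s≤s X⁺≤₁₃) (s≤s X⁺≤₂₄) ⟩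
      suc (b₁ + b₃) + suc (b₂ + suc b₄)  ≡⟨ regroup b₁ b₂ b₃ b₄ ⟩
      3 + (b₁ + (b₂ + (b₃ + b₄)))        ≡⟨ cong (3 +_) length-blocks ⟨
      3 + length blocks                  ∎
      where
      b₁ b₂ b₃ b₄ : ℕ
      b₁ = length (filter (ℤₚ._≤? v) X⁺)
      b₂ = length (filter (ℤₚ._≤? w) X⁺)
      b₃ = length (filter (v ℤₚ.<?_) X⁺)
      b₄ = length (X⁺>w ∖ hi)
      X≤1+X⁺ : length X ≤ suc (length X⁺)
      X≤1+X⁺ = length≤1+length-∖ lo X!
      X⁺≤₁₃ : length X⁺ ≤ b₁ + b₃
      X⁺≤₁₃ = length≤length-filter+length-filter (ℤₚ._≤? v) (v ℤₚ.<?_) X⁺ (λ {a} _ → ≤⊎> a v)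
      X⁺≤₂₄ : length X⁺ ≤ b₂ + suc b₄
      X⁺≤₂₄ = ℕₚ.≤-trans
        (length≤length-filter+length-filter (ℤₚ._≤? w) (w ℤₚ.<?_) X⁺ (λ {a} _ → ≤⊎> a w))
        (ℕₚ.+-monoʳ-≤ b₂ (length≤1+length-∖ hi (Unique.filter⁺ (w ℤₚ.<?_) (∖-unique X!))))
      length-blocks : length blocks ≡ b₁ + (b₂ + (b₃ + b₄))
      length-blocks =
        trans (length-map-++ _ (filter (ℤₚ._≤? v) X⁺) _) (cong (b₁ +_)
        (trans (length-map-++ _ (filter (ℤₚ._≤? w) X⁺) _) (cong (b₂ +_)
        (trans (length-map-++ _ (filter (v ℤₚ.<?_) X⁺) _) (cong (b₃ +_)
        (length-map (ℤ._+ hi) (X⁺>w ∖ hi)))))))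
      regroup : ∀ b₁ b₂ b₃ b₄ → suc (b₁ + b₃) + suc (b₂ + suc b₄) ≡ 3 + (b₁ + (b₂ + (b₃ + b₄)))
      regroup = solve-∀

    T⊆blocks : T ⊆ blocks
    T⊆blocks = critical⇒⊇ blocks-unique blocks-⊆ critical length≤3+length-blocks

    u+v'∉block₁ : u ℤ.+ v' ∉ block₁
    u+v'∉block₁ ∈₁ with ∈-block⁻ (ℤₚ._≤? v) _ ∈₁
    ... | a , _ , _ , a≤v , u+v'≡lo+a = ℤₚ.<⇒≢
      (ℤₚ.≤-<-trans (ℤₚ.+-monoʳ-≤ lo a≤v) (ℤₚ.+-mono-≤-< (proj₂ lo-least u∈X) v<v')) (sym u+v'≡lo+a)

    u+v'∈block₂ : u ℤ.+ v' ∈ block₂ → u ℤ.+ v' ≡ w ℤ.+ v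
    u+v'∈block₂ ∈₂ with ∈-block⁻ (ℤₚ._≤? w) _ ∈₂
    ... | a , a∈X , _ , a≤w , u+v'≡a+v with u ℤₚ.<? a
    ...   | yes u<a = trans u+v'≡a+v (cong (ℤ._+ v) (ℤₚ.≤-antisym a≤w (proj₂ (proj₂ u⋖w) a∈X u<a)))
    ...   | no  u≮a = contradiction (sym u+v'≡a+v) (ℤₚ.<⇒≢ (ℤₚ.+-mono-≤-< (ℤₚ.≮⇒≥ u≮a) v<v'))

    u+v'∉block₃ : u ℤ.+ v' ∉ block₃
    u+v'∉block₃ ∈₃ with ∈-block⁻ (v ℤₚ.<?_) _ ∈₃
    ... | a , a∈X , _ , v<a , u+v'≡w+a =
      ℤₚ.<⇒≢ (ℤₚ.+-mono-<-≤ u<w (proj₂ (proj₂ v⋖v') a∈X v<a)) u+v'≡w+a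

    u+v'∉block₄ : u ℤ.+ v' ∉ block₄
    u+v'∉block₄ ∈₄ with ∈-block₄⁻ ∈₄
    ... | a , _ , w<a , _ , u+v'≡a+hi =
      ℤₚ.<⇒≢ (ℤₚ.+-mono-<-≤ (ℤₚ.<-trans u<w w<a) (proj₂ hi-greatest v'∈X)) u+v'≡a+hi

    exchange : u ℤ.+ v' ≡ w ℤ.+ v
    exchange with ∈-++⁻ block₁ (T⊆blocks (sums u∈X v'∈X (ℤₚ.<⇒≢ u<v')))
      where
      u<v' : u ℤ.< v'
      u<v' = ℤₚ.<-trans u<w (ℤₚ.<-trans w<v v<v')
    ... | inj₁ ∈₁ = contradiction ∈₁ u+v'∉block₁
    ... | inj₂ ∈' with ∈-++⁻ block₂ ∈'
    ...   | inj₁ ∈₂ = u+v'∈block₂ ∈₂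
    ...   | inj₂ ∈'' with ∈-++⁻ block₃ ∈''
    ...     | inj₁ ∈₃ = contradiction ∈₃ u+v'∉block₃
    ...     | inj₂ ∈₄ = contradiction ∈₄ u+v'∉block₄

  successor : ∀ {x} → x ∈ X → x ℤ.< hi → ∃ (x ⋖_)
  successor {x} x∈X x<hi
    with least (filter (x ℤₚ.<?_) X)
               (filter-some (x ℤₚ.<?_) (Any.map (λ { refl → x<hi }) (proj₁ hi-greatest)))
  ... | y , y∈ , y-least with ∈-filter⁻ (x ℤₚ.<?_) {xs = X} y∈
  ... | y∈X , x<y = y , y∈X , x<y , λ z∈X x<z → y-least (∈-filter⁺ (x ℤₚ.<?_) z∈X x<z)

  infix 4 _covers-up-to_
  _covers-up-to_ : List ℤ → ℤ → Set
  L covers-up-to x = ∀ {z} → z ∈ X → z ℤ.≤ x → z ∈ L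

  lo-covered : (lo ∷ []) covers-up-to lo
  lo-covered z∈X z≤lo = here (ℤₚ.≤-antisym z≤lo (proj₂ lo-least z∈X))

  covers-∷ : ∀ {L x y} → L covers-up-to x → x ⋖ y → (y ∷ L) covers-up-to y
  covers-∷ {x = x} L-covers (_ , _ , y-least) {z} z∈X z≤y with x ℤₚ.<? z
  ... | yes x<z = here (ℤₚ.≤-antisym z≤y (y-least z∈X x<z))
  ... | no  x≮z = there (L-covers z∈X (ℤₚ.≮⇒≥ x≮z))

  short-cover⇒successor : ∀ {L x} → x ∈ X → L covers-up-to x → length L < length X → ∃ (x ⋖_)
  short-cover⇒successor {L} {x} x∈X L-covers |L|<|X| with x ℤₚ.<? hi
  ... | yes x<hi = successor x∈X x<hi
  ... | no  x≮hi = contradiction (Unique-⊆⇒length≤ X! X⊆L) (ℕₚ.<⇒≱ |L|<|X|)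
    where
    X⊆L : X ⊆ L
    X⊆L z∈X = L-covers z∈X (ℤₚ.≤-trans (proj₂ hi-greatest z∈X) (ℤₚ.≮⇒≥ x≮hi))

  module Enumeration (5≤|X| : 5 ≤ length X) where

    open ≡-Reasoning

    second : ∃ (lo ⋖_)
    second = short-cover⇒successor (proj₁ lo-least) lo-covered (ℕₚ.≤-trans (s≤s (s≤s z≤n)) 5≤|X|)

    a₂ : ℤ
    a₂ = proj₁ second
    lo⋖a₂ : lo ⋖ a₂
    lo⋖a₂ = proj₂ second

    d : ℤ
    d = a₂ - lo

    -- a₂ ⋖ a₃ cannot be compared with lo ⋖ a₂ directly; both are compared with a₄ ⋖ a₅,
    -- which exists because |X| ≥ 5.
    gap-after-second : ∀ {a₃} → a₂ ⋖ a₃ → a₃ ≡ a₂ ℤ.+ d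
    gap-after-second {a₃} a₂⋖a₃ = ∙-cancelʳ a₄ a₃ (a₂ ℤ.+ d) (begin
      a₃ ℤ.+ a₄                  ≡⟨ inner ⟨
      a₂ ℤ.+ a₅                  ≡⟨ regroup₁ a₂ a₅ lo ⟩
      d ℤ.+ (lo ℤ.+ a₅)          ≡⟨ cong (λ t → d ℤ.+ t) outer ⟩
      d ℤ.+ (a₂ ℤ.+ a₄)          ≡⟨ regroup₂ a₂ a₄ lo ⟩
      (a₂ ℤ.+ d) ℤ.+ a₄          ∎)
      where
      cover₃ : (a₃ ∷ a₂ ∷ lo ∷ []) covers-up-to a₃
      cover₃ = covers-∷ (covers-∷ lo-covered lo⋖a₂) a₂⋖a₃
      third : ∃ (a₃ ⋖_)
      third = short-cover⇒successor (proj₁ a₂⋖a₃) cover₃ (ℕₚ.≤-trans (ℕₚ.n≤1+n 4) 5≤|X|)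
      a₄ : ℤ
      a₄ = proj₁ third
      a₃⋖a₄ : a₃ ⋖ a₄
      a₃⋖a₄ = proj₂ third
      fourth : ∃ (a₄ ⋖_)
      fourth = short-cover⇒successor (proj₁ a₃⋖a₄) (covers-∷ cover₃ a₃⋖a₄) 5≤|X|
      a₅ : ℤ
      a₅ = proj₁ fourth
      a₄⋖a₅ : a₄ ⋖ a₅
      a₄⋖a₅ = proj₂ fourth
      a₃<a₄ : a₃ ℤ.< a₄
      a₃<a₄ = proj₁ (proj₂ a₃⋖a₄)
      outer : lo ℤ.+ a₅ ≡ a₂ ℤ.+ a₄
      outer = Exchange.exchange (proj₁ lo-least) lo⋖a₂ (proj₁ a₃⋖a₄) a₄⋖a₅
                (ℤₚ.<-trans (proj₁ (proj₂ a₂⋖a₃)) a₃<a₄)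
      inner : a₂ ℤ.+ a₅ ≡ a₃ ℤ.+ a₄
      inner = Exchange.exchange (proj₁ lo⋖a₂) a₂⋖a₃ (proj₁ a₃⋖a₄) a₄⋖a₅ a₃<a₄
      regroup₁ : ∀ a b l → a ℤ.+ b ≡ (a - l) ℤ.+ (l ℤ.+ b)
      regroup₁ = ℤ-Ring.solve-∀
      regroup₂ : ∀ a b l → (a - l) ℤ.+ (a ℤ.+ b) ≡ (a ℤ.+ (a - l)) ℤ.+ b
      regroup₂ = ℤ-Ring.solve-∀

    gap : ∀ {x y} → x ∈ X → x ⋖ y → y ≡ x ℤ.+ d
    gap {x} {y} x∈X x⋖y with x ℤₚ.≟ lo | x ℤₚ.≟ a₂
    ... | yes refl | _        = trans (⋖-unique x⋖y lo⋖a₂) (sym (m+[n-m]≡n lo a₂))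
    ... | no  _    | yes refl = gap-after-second x⋖y
    ... | no  x≢lo | no  x≢a₂ = ∙-cancelˡ lo y (x ℤ.+ d) (begin
      lo ℤ.+ y          ≡⟨ Exchange.exchange (proj₁ lo-least) lo⋖a₂ x∈X x⋖y a₂<x ⟩
      a₂ ℤ.+ x          ≡⟨ regroup a₂ x lo ⟩
      lo ℤ.+ (x ℤ.+ d)  ∎)
      where
      lo<x : lo ℤ.< x
      lo<x = ℤₚ.≤∧≢⇒< (proj₂ lo-least x∈X) (λ lo≡x → x≢lo (sym lo≡x))
      a₂<x : a₂ ℤ.< x
      a₂<x = ℤₚ.≤∧≢⇒< (proj₂ (proj₂ lo⋖a₂) x∈X lo<x) (λ a₂≡x → x≢a₂ (sym a₂≡x))
      regroup : ∀ a x l → a ℤ.+ x ≡ l ℤ.+ (x ℤ.+ (a - l))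
      regroup = ℤ-Ring.solve-∀

    term : ℕ → ℤ
    term i = lo ℤ.+ (ℤ.+ i) ℤ.* d

    term-suc : ∀ i → term (suc i) ≡ term i ℤ.+ d
    term-suc i = regroup lo (ℤ.+ i) d
      where
      regroup : ∀ l k e → l ℤ.+ (ℤ.+ 1 ℤ.+ k) ℤ.* e ≡ (l ℤ.+ k ℤ.* e) ℤ.+ e
      regroup = ℤ-Ring.solve-∀

    initial-segment : ∀ i → i < length X → term i ∈ X × applyUpTo term (suc i) covers-up-to term i
    initial-segment zero _ =
      subst (_∈ X) (sym term-zero) (proj₁ lo-least) ,
      λ z∈X z≤ → here (trans (ℤₚ.≤-antisym (subst (_ ℤ.≤_) term-zero z≤) (proj₂ lo-least z∈X))
                             (sym term-zero))
      where
      term-zero : term 0 ≡ lo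
      term-zero = ℤₚ.+-identityʳ lo
    initial-segment (suc i) 1+i<|X| with initial-segment i (ℕₚ.<-trans (ℕₚ.n<1+n i) 1+i<|X|)
    ... | termᵢ∈X , covered with short-cover⇒successor termᵢ∈X covered
                                   (subst (_< length X) (sym (length-applyUpTo term (suc i))) 1+i<|X|)
    ... | y , termᵢ⋖y =
      subst (_∈ X) y≡ (proj₁ termᵢ⋖y) ,
      λ z∈X z≤ → widen (covers-∷ covered termᵢ⋖y z∈X (subst (_ ℤ.≤_) (sym y≡) z≤))
      where
      y≡ : y ≡ term (suc i)
      y≡ = trans (gap termᵢ∈X termᵢ⋖y) (sym (term-suc i))
      widen : y ∷ applyUpTo term (suc i) ⊆ applyUpTo term (suc (suc i))
      widen (here refl) = subst (_∈ applyUpTo term (suc (suc i))) (sym y≡)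
                                (∈-applyUpTo⁺ term (ℕₚ.n<1+n (suc i)))
      widen (there z∈) = applyUpTo-⊆-suc term (suc i) z∈

    d≢0 : d ≢ ℤ.+ 0
    d≢0 d≡0 = ℤₚ.<⇒≢ (proj₁ (proj₂ lo⋖a₂)) (begin
      lo                ≡⟨ ℤₚ.+-identityʳ lo ⟨
      lo ℤ.+ ℤ.+ 0      ≡⟨ cong (λ t → lo ℤ.+ t) d≡0 ⟨
      lo ℤ.+ d          ≡⟨ m+[n-m]≡n lo a₂ ⟩
      a₂                ∎)

    term-injective : ∀ {i j} → term i ≡ term j → i ≡ j
    term-injective {i} {j} eq =
      ℤₚ.+-injective (ℤₚ.*-cancelʳ-≡ (ℤ.+ i) (ℤ.+ j) d {{ℤ.≢-nonZero d≢0}} (∙-cancelˡ lo _ _ eq))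

    ∈X⇔∃term : ∀ x → x ∈ X ⇔ (∃[ i ] i < length X × x ≡ term i)
    ∈X⇔∃term x = mk⇔ (λ x∈X → ∈-applyUpTo⁻ term (X⊆terms x∈X))
                (λ { (i , i<|X| , refl) → proj₁ (initial-segment i i<|X|) })
      where
      terms : List ℤ
      terms = applyUpTo term (length X)
      terms-unique : Unique terms
      terms-unique = Unique.applyUpTo⁺₁ term (length X) (λ i<j _ eq → ℕₚ.<⇒≢ i<j (term-injective eq))
      terms⊆X : terms ⊆ X
      terms⊆X z∈ with ∈-applyUpTo⁻ term z∈
      ... | i , i<|X| , refl = proj₁ (initial-segment i i<|X|)
      X⊆terms : X ⊆ terms
      X⊆terms = Unique-⊆-length≤⇒⊇ terms-unique terms⊆X
                  (ℕₚ.≤-reflexive (sym (length-applyUpTo term (length X))))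

critical-square⇒standard : ∀ A {T} → 5 ≤ ∣ A ∣ → elems A +̂ elems A ⊆ T →
  length T + 3 ≡ ∣ A ∣ + ∣ A ∣ → IsStandard A
critical-square⇒standard A 5≤|A| sums critical = lo , d , d≢0 , ∈X⇔∃term
  where
  A≢[] : 1 ≤ ∣ A ∣
  A≢[] = ℕₚ.≤-trans (s≤s z≤n) 5≤|A|
  lo : ℤ
  lo = proj₁ (least (elems A) A≢[])
  open CriticalSquare (unique A) sums critical
         (proj₂ (least (elems A) A≢[])) (proj₂ (greatest (elems A) A≢[]))
  open Enumeration 5≤|A|

index-sum-< : ∀ {i j k} → i < j → j ≤ suc k → ∃[ s ] i + j ≡ suc s × s ≤ k + k
index-sum-< {i} {suc j} (s≤s i≤j) (s≤s j≤k) =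
  i + j , ℕₚ.+-suc i j , ℕₚ.+-mono-≤ (ℕₚ.≤-trans i≤j j≤k) j≤k

index-sum-≢ : ∀ {i j k} → i ≢ j → i ≤ suc k → j ≤ suc k → ∃[ s ] i + j ≡ suc s × s ≤ k + k
index-sum-≢ {i} {j} i≢j i≤ j≤ with ℕₚ.<-cmp i j
... | tri< i<j _ _ = index-sum-< i<j j≤
... | tri≈ _ i≡j _ = contradiction i≡j i≢j
... | tri> _ _ j<i with index-sum-< j<i i≤
...   | s , j+i≡ , s≤ = s , trans (ℕₚ.+-comm i j) j+i≡ , s≤

progression-sum : ∀ τ d i j →
  (τ ℤ.+ (ℤ.+ i) ℤ.* d) ℤ.+ (τ ℤ.+ (ℤ.+ j) ℤ.* d) ≡ (τ ℤ.+ τ) ℤ.+ (ℤ.+ (i + j)) ℤ.* d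
progression-sum τ d i j = trans (regroup τ d (ℤ.+ i) (ℤ.+ j))
  (cong (λ t → (τ ℤ.+ τ) ℤ.+ t ℤ.* d) (sym (ℤₚ.pos-+ i j)))
  where
  regroup : ∀ τ d a b → (τ ℤ.+ a ℤ.* d) ℤ.+ (τ ℤ.+ b ℤ.* d) ≡ (τ ℤ.+ τ) ℤ.+ (a ℤ.+ b) ℤ.* d
  regroup = ℤ-Ring.solve-∀

standard-restrictedSum-bound : ∀ A B {k} → A ≐ B → IsStandard A → ∣ A ∣ ≡ 2 + k →
  restrictedSumCard A B ≤ suc (k + k)
standard-restrictedSum-bound A B {k} A≐B (τ , d , _ , A⇔) |A|≡2+k = begin
  restrictedSumCard A B              ≤⟨ Unique-⊆⇒length≤ (restrictedSumList-unique A B) sums⊆ ⟩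
  length (applyUpTo sum (suc (k + k))) ≡⟨ length-applyUpTo sum (suc (k + k)) ⟩
  suc (k + k)                        ∎
  where
  open ℕₚ.≤-Reasoning
  term : ℕ → ℤ
  term i = τ ℤ.+ (ℤ.+ i) ℤ.* d
  sum : ℕ → ℤ
  sum s = (τ ℤ.+ τ) ℤ.+ (ℤ.+ suc s) ℤ.* d
  index : ∀ {x} → x ∈ elems A → ∃[ i ] i ≤ suc k × x ≡ term i
  index {x} x∈A with Equivalence.to (A⇔ x) x∈A
  ... | i , i<|A| , x≡ = i , ℕₚ.≤-pred (subst (i <_) |A|≡2+k i<|A|) , x≡
  sums⊆ : restrictedSumList A B ⊆ applyUpTo sum (suc (k + k))
  sums⊆ z∈ with ∈-restrictedSumList⁻ A B z∈
  ... | a , b , a∈A , b∈B , a≢b , refl with index a∈A | index (Equivalence.from (A≐B b) b∈B)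
  ...   | i , i≤ , refl | j , j≤ , refl with index-sum-≢ (λ i≡j → a≢b (cong term i≡j)) i≤ j≤
  ...     | s , i+j≡1+s , s≤ =
    subst (_∈ applyUpTo sum (suc (k + k)))
      (sym (trans (progression-sum τ d i j) (cong (λ t → (τ ℤ.+ τ) ℤ.+ (ℤ.+ t) ℤ.* d) i+j≡1+s)))
      (∈-applyUpTo⁺ sum (s≤s s≤))

standard⇒critical : ∀ A B → 2 ≤ ∣ A ∣ → A ≐ B → IsStandard A →
  restrictedSumCard A B + 3 ≡ ∣ A ∣ + ∣ B ∣
standard⇒critical A B 2≤|A| A≐B standard = ℕₚ.≤-antisym (begin
  restrictedSumCard A B + 3  ≤⟨ ℕₚ.+-monoˡ-≤ 3 (standard-restrictedSum-bound A B A≐B standard |A|≡2+k) ⟩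
  suc (k + k) + 3            ≡⟨ regroup k ⟩
  (2 + k) + (2 + k)          ≡⟨ cong₂ _+_ |A|≡2+k (trans (sym (≐⇒∣∣≡ A B A≐B)) |A|≡2+k) ⟨
  ∣ A ∣ + ∣ B ∣              ∎) (begin
  ∣ A ∣ + ∣ B ∣              ≤⟨ restrictedSum-lower-bound (unique A) (unique B) 1≤|A| 1≤|B| sums ⟩
  3 + restrictedSumCard A B  ≡⟨ ℕₚ.+-comm 3 (restrictedSumCard A B) ⟩
  restrictedSumCard A B + 3  ∎)
  where
  open ℕₚ.≤-Reasoning
  k : ℕ
  k = ∣ A ∣ ∸ 2
  |A|≡2+k : ∣ A ∣ ≡ 2 + k
  |A|≡2+k = sym (ℕₚ.m+[n∸m]≡n 2≤|A|)
  1≤|A| : 1 ≤ ∣ A ∣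
  1≤|A| = ℕₚ.≤-trans (s≤s z≤n) 2≤|A|
  sums : elems A +̂ elems B ⊆ restrictedSumList A B
  sums = restrictedSumList-⊇ A B
  1≤|B| : 1 ≤ ∣ B ∣
  1≤|B| = subst (1 ≤_) (≐⇒∣∣≡ A B A≐B) 1≤|A|
  regroup : ∀ k → suc (k + k) + 3 ≡ (2 + k) + (2 + k)
  regroup = solve-∀

theorem4 : (A B : FinSetℤ) → 5 ≤ ∣ A ∣ → 2 ≤ ∣ B ∣ →
    ((restrictedSumCard A B + 3 ≡ ∣ A ∣ + ∣ B ∣) ⇔ ((A ≐ B) × IsStandard A))
theorem4 A B 5≤|A| 2≤|B| = mk⇔ critical⇒standard-pair λ (A≐B , standard) →
  standard⇒critical A B (ℕₚ.≤-trans (ℕₚ.m≤m+n 2 3) 5≤|A|) A≐B standard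
  where
  critical⇒standard-pair : restrictedSumCard A B + 3 ≡ ∣ A ∣ + ∣ B ∣ → (A ≐ B) × IsStandard A
  critical⇒standard-pair critical = A≐B , critical-square⇒standard A 5≤|A| sums critical′
    where
    A≐B : A ≐ B
    A≐B = critical⇒≐ A B (ℕₚ.≤-trans (s≤s z≤n) 5≤|A|) (ℕₚ.≤-trans (s≤s z≤n) 2≤|B|) critical
    sums : elems A +̂ elems A ⊆ restrictedSumList A B
    sums a∈A a'∈A = restrictedSumList-⊇ A B a∈A (Equivalence.to (A≐B _) a'∈A)
    critical′ : restrictedSumCard A B + 3 ≡ ∣ A ∣ + ∣ A ∣
    critical′ = trans critical (cong (∣ A ∣ +_) (sym (≐⇒∣∣≡ A B A≐B)))
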